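{- Let $m\ge 5$ and let $n\ge 3$ be odd. Let $G(*)$ be the subgraph of $G_{m,n}=S_m\Box P_n$ induced by $V(S_m)\times\{1,\tfrac{n+1}{2},n\}$. Then the radio number of $G(*)$ in $G_{m,n}$ satisfies $$rn(G(*))\le \tfrac{1}{2}\left(2mn+4m-n+7\right).$$
   Context: $S_m$ is the star on $m$ vertices with center $c$ and leaves; $P_n$ is the path with vertices $1,\dots,n$. $G_{m,n}=S_m\Box P_n$ has vertex set $V(S_m)\times\{1,\dots,n\}$, with $(a,i)\sim(b,j)$ iff ($a=b$ and $|i-j|=1$) or ($i=j$ and $ab\in E(S_m)$). Its distance is $d((a,i),(b,j))=d_{S_m}(a,b)+|i-j|$ and its diameter is $n+1$. For a subset $H$ of vertices (or induced subgraph) of $G_{m,n}$, a radio labeling of $H$ in $G_{m,n}$ is a function $f:V(H)\to\mathbb{Z}_{\ge 0}$ with $|f(u)-f(v)|\ge \mathrm{diam}(G_{m,n})+1-d_{G_{m,n}}(u,v)$ for all distinct $u,v\in V(H)$ (distances and diameter taken in $G_{m,n}$); its span is $\max f-\min f$, and $rn(H)$ is the minimum span over all such labelings. -}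

module Defs where

open import Data.Nat using (ℕ; zero; suc; _+_; _*_; _∸_; _⊔_; _⊓_; ∣_-_∣; _/_)
open import Data.Fin using (Fin; toℕ)
open import Data.Fin.Properties using () renaming (_≟_ to _≟ᶠ_)
open import Data.Product using (_×_; _,_)
open import Data.List using (List; map; concatMap; foldr; allFin)
open import Relation.Nullary using (yes; no)

-- The star S_m: vertex set Fin m, center = the vertex 0, leaves = all others.
-- Distance in S_m: 0 if equal, 1 if exactly one endpoint is the center, else 2.
dStar : {m : ℕ} → Fin m → Fin m → ℕ
dStar a b with a ≟ᶠ b
... | yes _ = 0
... | no _ with toℕ a | toℕ b
...   | zero  | _     = 1
...   | suc _ | zero  = 1
...   | suc _ | suc _ = 2

-- Vertices of G_{m,n} = S_m □ P_n : (star vertex, path vertex in {1..n}).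
-- Distance d((a,i),(b,j)) = d_S(a,b) + |i - j|.
dG : {m : ℕ} → Fin m × ℕ → Fin m × ℕ → ℕ
dG (a , i) (b , j) = dStar a b + ∣ i - j ∣

diamG : ℕ → ℕ
diamG n = n + 1

level : ℕ → Fin 3 → ℕ
level n Fin.zero = 1
level n (Fin.suc Fin.zero) = (n + 1) / 2
level n (Fin.suc (Fin.suc Fin.zero)) = n

emb : {m : ℕ} → ℕ → Fin m × Fin 3 → Fin m × ℕ
emb n (a , k) = a , level n k

verticesStar : (m : ℕ) → List (Fin m × Fin 3)
verticesStar m = concatMap (λ a → map (λ k → a , k) (allFin 3)) (allFin m)

IsRadioLabeling : (m n : ℕ) → (Fin m × Fin 3 → ℕ) → Set
IsRadioLabeling m n f =
  (u v : Fin m × Fin 3) → ¬ (emb n u ≡ emb n v) →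
  diamG n + 1 ≤ ∣ f u - f v ∣ + dG (emb n u) (emb n v)
  where
  open import Relation.Nullary using (¬_)
  open import Relation.Binary.PropositionalEquality using (_≡_)
  open import Data.Nat using (_≤_)

maxL : List ℕ → ℕ
maxL = foldr _⊔_ 0

-- minimum of a list (for nonempty lists; the seed maxL xs does not change the min)
minL : List ℕ → ℕ
minL xs = foldr _⊓_ (maxL xs) xs

span : (m n : ℕ) → (Fin m × Fin 3 → ℕ) → ℕ
span m n f = maxL (map f (verticesStar m)) ∸ minL (map f (verticesStar m))

{-# OPTIONS --safe #-}
module Submission where

-- Write n = 2k + 1 and P = 2k + 3 = diam + 1, and let 0 be the centre of the star. The labels are
-- handed out in m rounds of length P: in round t the middle copy of vertex t gets tP + 3, the
-- bottom copy of vertex t - 1 gets tP + k + 4 and the top copy of vertex t + 2 gets tP + k + 5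
-- (indices mod m), with small corrections in the first two rounds and at the centre, whose star
-- distance to everything is 1 rather than 2. On one level the labels are then P apart, which is
-- all the radio condition asks for there. Between levels it only asks for a label gap of
-- k + 3 - d, resp. 3 - d, at star distance d, and the offsets are chosen so that a gap one short
-- of k + 3, resp. 3, only occurs between copies of distinct vertices and a gap two short only
-- between copies of distinct leaves. The largest label, (m - 1)P + k + 6 on the top copy of the
-- centre, is exactly the claimed bound on the span.

open import Defs
open import Data.Nat using (ℕ; zero; suc; _+_; _*_; _≤_; _<_; _∸_; z≤n; s≤s; ∣_-_∣; _/_)
open import Data.Nat.Properties
open import Data.Nat.DivMod using (m*n/n≡m)
open import Data.Nat.Tactic.RingSolver using (solve)
open import Data.Product using (Σ; _×_; _,_)
open import Data.Sum using (inj₁; inj₂)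
open import Data.Fin using (Fin; toℕ) renaming (zero to fz; suc to fs)
open import Data.Fin.Properties using (toℕ-injective; toℕ<n) renaming (_≟_ to _≟ᶠ_)
open import Data.List using (List; []; _∷_; map)
open import Data.Empty using (⊥-elim)
open import Function.Base using (_∋_; _∘_; _$_)
open import Relation.Binary.Definitions using (tri<; tri≈; tri>)
open import Relation.Binary.PropositionalEquality
open import Relation.Nullary using (yes; no)

m+o≡n⇒m≤n : ∀ {m n} o → m + o ≡ n → m ≤ n
m+o≡n⇒m≤n {m} o refl = m≤m+n m o

m+g≤n⇒g≤∣m-n∣ : ∀ {m n g} → m + g ≤ n → g ≤ ∣ m - n ∣
m+g≤n⇒g≤∣m-n∣ {m} {n} {g} m+g≤n = begin
  g         ≡⟨ m+n∸m≡n m g ⟨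
  m + g ∸ m ≤⟨ ∸-monoˡ-≤ m m+g≤n ⟩
  n ∸ m     ≡⟨ m≤n⇒∣m-n∣≡n∸m (m+n≤o⇒m≤o m m+g≤n) ⟨
  ∣ m - n ∣ ∎
  where open ≤-Reasoning

n+g≤m⇒g≤∣m-n∣ : ∀ {m n g} → n + g ≤ m → g ≤ ∣ m - n ∣
n+g≤m⇒g≤∣m-n∣ {m} {n} {g} n+g≤m = subst (g ≤_) (∣-∣-comm n m) (m+g≤n⇒g≤∣m-n∣ n+g≤m)

module Spaced (P : ℕ) (F : ℕ → ℕ) (step : ∀ t → F t + P ≤ F (suc t)) where

  <⇒+P≤ : ∀ {s t} → s < t → F s + P ≤ F t
  <⇒+P≤ {s} {suc t} (s≤s s≤t) with m≤n⇒m<n∨m≡n s≤t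
  ... | inj₂ refl = step s
  ... | inj₁ s<t = ≤-trans (<⇒+P≤ s<t) (≤-trans (m≤m+n (F t) P) (step t))

  monotone : ∀ {s t} → s ≤ t → F s ≤ F t
  monotone {s} {t} s≤t with m≤n⇒m<n∨m≡n s≤t
  ... | inj₂ refl = ≤-refl
  ... | inj₁ s<t = ≤-trans (m≤m+n (F s) P) (<⇒+P≤ s<t)

  ≢⇒P≤∣-∣ : ∀ {s t} → s ≢ t → P ≤ ∣ F s - F t ∣
  ≢⇒P≤∣-∣ {s} {t} s≢t with <-cmp s t
  ... | tri< s<t _ _ = m+g≤n⇒g≤∣m-n∣ (<⇒+P≤ s<t)
  ... | tri≈ _ s≡t _ = ⊥-elim (s≢t s≡t)
  ... | tri> _ _ t<s = n+g≤m⇒g≤∣m-n∣ (<⇒+P≤ t<s)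

maxL-map-≤ : ∀ {A : Set} (f : A → ℕ) {B} (xs : List A) → (∀ x → f x ≤ B) → maxL (map f xs) ≤ B
maxL-map-≤ f [] f≤B = z≤n
maxL-map-≤ f (x ∷ xs) f≤B = ⊔-lub (f≤B x) (maxL-map-≤ f xs f≤B)

span-≤ : ∀ m n (f : Fin m × Fin 3 → ℕ) {B} → (∀ x → f x ≤ B) → span m n f ≤ B
span-≤ m n f f≤B =
  ≤-trans (m∸n≤m (maxL (map f (verticesStar m))) (minL (map f (verticesStar m))))
    (maxL-map-≤ f (verticesStar m) f≤B)

record StarBounds (i j D : ℕ) : Set where
  field
    distinct : i ≢ j → 1 ≤ D
    distinct-leaves : i ≢ j → i ≢ 0 → j ≢ 0 → 2 ≤ D

open StarBounds

StarBounds-sym : ∀ {i j D} → StarBounds i j D → StarBounds j i D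
StarBounds-sym b = record
  { distinct = λ j≢i → distinct b (j≢i ∘ sym)
  ; distinct-leaves = λ j≢i j≢0 i≢0 → distinct-leaves b (j≢i ∘ sym) i≢0 j≢0
  }

dStar-bounds : ∀ {m} (a b : Fin m) → StarBounds (toℕ a) (toℕ b) (dStar a b)
dStar-bounds a b = record { distinct = ≥1 ; distinct-leaves = ≥2 }
  where
  ≥1 : toℕ a ≢ toℕ b → 1 ≤ dStar a b
  ≥1 a≢b with a ≟ᶠ b
  ... | yes refl = ⊥-elim (a≢b refl)
  ... | no _ with toℕ a | toℕ b
  ...   | zero | _ = s≤s z≤n
  ...   | suc _ | zero = s≤s z≤n
  ...   | suc _ | suc _ = s≤s z≤n

  ≥2 : toℕ a ≢ toℕ b → toℕ a ≢ 0 → toℕ b ≢ 0 → 2 ≤ dStar a b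
  ≥2 a≢b a≢0 b≢0 with a ≟ᶠ b
  ... | yes refl = ⊥-elim (a≢b refl)
  ... | no _ with toℕ a | toℕ b | a≢0 | b≢0
  ...   | zero | _ | a≢0′ | _ = ⊥-elim (a≢0′ refl)
  ...   | suc _ | zero | _ | b≢0′ = ⊥-elim (b≢0′ refl)
  ...   | suc _ | suc _ | _ | _ = s≤s (s≤s z≤n)

levelGap : ℕ → Fin 3 → Fin 3 → ℕ
levelGap k fz fz = 0
levelGap k fz (fs fz) = k
levelGap k fz (fs (fs fz)) = 2 * k
levelGap k (fs fz) fz = k
levelGap k (fs fz) (fs fz) = 0
levelGap k (fs fz) (fs (fs fz)) = k
levelGap k (fs (fs fz)) fz = 2 * k
levelGap k (fs (fs fz)) (fs fz) = k
levelGap k (fs (fs fz)) (fs (fs fz)) = 0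

middle-level : ∀ k → level (2 * k + 1) (fs fz) ≡ suc k
middle-level k = trans (cong (_/ 2) (2 * k + 1 + 1 ≡ (1 + k) * 2 ∋ solve (k ∷ []))) (m*n/n≡m (suc k) 2)

∣level-level∣≡levelGap : ∀ k l l′ →
  ∣ level (2 * k + 1) l - level (2 * k + 1) l′ ∣ ≡ levelGap k l l′
∣level-level∣≡levelGap k fz fz = refl
∣level-level∣≡levelGap k fz (fs fz) = cong (λ x → ∣ 1 - x ∣) (middle-level k)
∣level-level∣≡levelGap k fz (fs (fs fz)) = cong ∣ 1 -_∣ (+-comm (2 * k) 1)
∣level-level∣≡levelGap k (fs fz) fz =
  trans (cong (λ x → ∣ x - 1 ∣) (middle-level k)) (∣-∣-identityʳ k)
∣level-level∣≡levelGap k (fs fz) (fs fz) = ∣n-n∣≡0 (level (2 * k + 1) (fs fz))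
∣level-level∣≡levelGap k (fs fz) (fs (fs fz)) = begin
  ∣ level (2 * k + 1) (fs fz) - 2 * k + 1 ∣
    ≡⟨ cong₂ ∣_-_∣ (middle-level k) (2 * k + 1 ≡ suc k + k ∋ solve (k ∷ [])) ⟩
  ∣ suc k - suc k + k ∣
    ≡⟨ ∣m-m+n∣≡n (suc k) k ⟩
  k ∎
  where open ≡-Reasoning
∣level-level∣≡levelGap k (fs (fs fz)) fz =
  trans (∣-∣-comm (2 * k + 1) 1) (∣level-level∣≡levelGap k fz (fs (fs fz)))
∣level-level∣≡levelGap k (fs (fs fz)) (fs fz) =
  trans (∣-∣-comm (2 * k + 1) _) (∣level-level∣≡levelGap k (fs fz) (fs (fs fz)))
∣level-level∣≡levelGap k (fs (fs fz)) (fs (fs fz)) = ∣n-n∣≡0 (2 * k + 1)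

-- The star has m = 5 + M vertices and n = 2k + 1.
module Labeling (M k : ℕ) where

  middle : ℕ → ℕ
  middle 0 = 0
  middle 1 = 2 * k + 3 + 1
  middle (suc (suc i)) = (2 + i) * (2 * k + 3) + 3

  bottomSeq : ℕ → ℕ
  bottomSeq 0 = 2 * k + 3 + k + 3
  bottomSeq (suc i) = (2 + i) * (2 * k + 3) + k + 4

  bottom : ℕ → ℕ
  bottom i with i ≟ 4 + M
  ... | yes _ = k + 2
  ... | no _ = bottomSeq i

  topSeq : ℕ → ℕ
  topSeq 0 = k + 3
  topSeq (suc t) = (1 + t) * (2 * k + 3) + k + 5

  top : ℕ → ℕ
  -- The + 1 separates the centre from the bottom copy of vertex m - 2, at star distance 1.
  top 0 = suc (topSeq (4 + M))
  top 1 = topSeq (3 + M)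
  top (suc (suc j)) = topSeq j

  label : Fin 3 → ℕ → ℕ
  label fz = bottom
  label (fs fz) = middle
  label (fs (fs fz)) = top

  record Radio (x y D l : ℕ) : Set where
    constructor radio
    field
      bound : 2 * k + 1 + 1 + 1 ≤ ∣ x - y ∣ + (D + l)

  radio-sym : ∀ {x y D l} → Radio x y D l → Radio y x D l
  radio-sym {x} {y} {D} {l} (radio bound) =
    radio (subst (λ z → 2 * k + 1 + 1 + 1 ≤ z + (D + l)) (∣-∣-comm x y) bound)

  radio-same-level : ∀ {x y D} → 2 * k + 3 ≤ ∣ x - y ∣ → Radio x y D 0
  radio-same-level {D = D} gap =
    radio (≤-trans (≤-reflexive (2 * k + 1 + 1 + 1 ≡ 2 * k + 3 ∋ solve (k ∷ [])))
      (≤-trans gap (m≤m+n _ (D + 0))))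

  radio-k↑ : ∀ {x y D} c s → c + s ≡ 3 → s ≤ D → x + (k + c) ≤ y → Radio x y D k
  radio-k↑ {x} {y} c s c+s≡3 star x+k+c≤y =
    radio (≤-trans (≤-reflexive split)
      (+-mono-≤ (m+g≤n⇒g≤∣m-n∣ {x} {y} x+k+c≤y) (+-monoˡ-≤ k star)))
    where
    split : 2 * k + 1 + 1 + 1 ≡ k + c + (s + k)
    split = trans (2 * k + 1 + 1 + 1 ≡ k + 3 + k ∋ solve (k ∷ []))
      (trans (cong (λ t → k + t + k) (sym c+s≡3))
        (k + (c + s) + k ≡ k + c + (s + k) ∋ solve (k ∷ c ∷ s ∷ [])))

  radio-k↓ : ∀ {x y D} c s → c + s ≡ 3 → s ≤ D → y + (k + c) ≤ x → Radio x y D k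
  radio-k↓ c s c+s≡3 star y+k+c≤x = radio-sym (radio-k↑ c s c+s≡3 star y+k+c≤x)

  radio-2k↑ : ∀ {x y D} c s → c + s ≡ 3 → s ≤ D → x + c ≤ y → Radio x y D (2 * k)
  radio-2k↑ {x} {y} c s c+s≡3 star x+c≤y =
    radio (≤-trans (≤-reflexive split)
      (+-mono-≤ (m+g≤n⇒g≤∣m-n∣ {x} {y} x+c≤y) (+-monoˡ-≤ (2 * k) star)))
    where
    split : 2 * k + 1 + 1 + 1 ≡ c + (s + 2 * k)
    split = trans (2 * k + 1 + 1 + 1 ≡ 3 + 2 * k ∋ solve (k ∷ []))
      (trans (cong (_+ 2 * k) (sym c+s≡3)) (+-assoc c s (2 * k)))

  radio-2k↓ : ∀ {x y D} c s → c + s ≡ 3 → s ≤ D → y + c ≤ x → Radio x y D (2 * k)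
  radio-2k↓ c s c+s≡3 star y+c≤x = radio-sym (radio-2k↑ c s c+s≡3 star y+c≤x)

  middle-step : ∀ t → middle t + (2 * k + 3) ≤ middle (suc t)
  middle-step 0 = m+o≡n⇒m≤n 1 (0 + (2 * k + 3) + 1 ≡ 2 * k + 3 + 1 ∋ solve (k ∷ []))
  middle-step 1 = m+o≡n⇒m≤n 2 (2 * k + 3 + 1 + (2 * k + 3) + 2 ≡ 2 * (2 * k + 3) + 3 ∋ solve (k ∷ []))
  middle-step (suc (suc i)) =
    ≤-reflexive ((2 + i) * (2 * k + 3) + 3 + (2 * k + 3) ≡ (3 + i) * (2 * k + 3) + 3 ∋ solve (i ∷ k ∷ []))

  bottomSeq-step : ∀ t → bottomSeq t + (2 * k + 3) ≤ bottomSeq (suc t)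
  bottomSeq-step 0 =
    m+o≡n⇒m≤n 1 (2 * k + 3 + k + 3 + (2 * k + 3) + 1 ≡ 2 * (2 * k + 3) + k + 4 ∋ solve (k ∷ []))
  bottomSeq-step (suc i) =
    ≤-reflexive ((2 + i) * (2 * k + 3) + k + 4 + (2 * k + 3) ≡ (3 + i) * (2 * k + 3) + k + 4 ∋ solve (i ∷ k ∷ []))

  topSeq-step : ∀ t → topSeq t + (2 * k + 3) ≤ topSeq (suc t)
  topSeq-step 0 = m+o≡n⇒m≤n 2 (k + 3 + (2 * k + 3) + 2 ≡ 1 * (2 * k + 3) + k + 5 ∋ solve (k ∷ []))
  topSeq-step (suc t) =
    ≤-reflexive ((1 + t) * (2 * k + 3) + k + 5 + (2 * k + 3) ≡ (2 + t) * (2 * k + 3) + k + 5 ∋ solve (t ∷ k ∷ []))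

  module Middle = Spaced (2 * k + 3) middle middle-step
  module BottomSeq = Spaced (2 * k + 3) bottomSeq bottomSeq-step
  module TopSeq = Spaced (2 * k + 3) topSeq topSeq-step

  middle-bottomLast : ∀ i {D} → StarBounds i (4 + M) D → Radio (middle i) (k + 2) D k
  middle-bottomLast zero b = radio-k↑ 2 1 refl (distinct b (λ ())) $ m+o≡n⇒m≤n 0
    (0 + (k + 2) + 0 ≡ k + 2 ∋ solve (k ∷ []))
  middle-bottomLast (suc zero) b = radio-k↓ 2 1 refl (distinct b (λ ())) $ m+o≡n⇒m≤n 0
    (k + 2 + (k + 2) + 0 ≡ 2 * k + 3 + 1 ∋ solve (k ∷ []))
  middle-bottomLast (suc (suc i)) _ = radio-k↓ 3 0 refl z≤n $ m+o≡n⇒m≤n (i * (2 * k + 3) + 2 * k + 4)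
    (k + 2 + (k + 3) + (i * (2 * k + 3) + 2 * k + 4) ≡ (2 + i) * (2 * k + 3) + 3 ∋ solve (i ∷ k ∷ []))

  middle-bottomSeq : ∀ i j {D} → StarBounds i j D → Radio (middle i) (bottomSeq j) D k
  middle-bottomSeq zero zero _ = radio-k↑ 3 0 refl z≤n $ m+o≡n⇒m≤n (2 * k + 3)
    (0 + (k + 3) + (2 * k + 3) ≡ 2 * k + 3 + k + 3 ∋ solve (k ∷ []))
  middle-bottomSeq (suc zero) zero b = radio-k↑ 2 1 refl (distinct b (λ ())) $ m+o≡n⇒m≤n 0
    (2 * k + 3 + 1 + (k + 2) + 0 ≡ 2 * k + 3 + k + 3 ∋ solve (k ∷ []))
  middle-bottomSeq (suc (suc i)) zero _ = radio-k↓ 3 0 refl z≤n $ m+o≡n⇒m≤n (i * (2 * k + 3))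
    (2 * k + 3 + k + 3 + (k + 3) + (i * (2 * k + 3)) ≡ (2 + i) * (2 * k + 3) + 3 ∋ solve (i ∷ k ∷ []))
  middle-bottomSeq zero (suc j) _ = radio-k↑ 3 0 refl z≤n $ m+o≡n⇒m≤n ((2 + j) * (2 * k + 3) + 1)
    (0 + (k + 3) + ((2 + j) * (2 * k + 3) + 1) ≡ (2 + j) * (2 * k + 3) + k + 4 ∋ solve (j ∷ k ∷ []))
  middle-bottomSeq (suc zero) (suc j) _ = radio-k↑ 3 0 refl z≤n $ m+o≡n⇒m≤n ((1 + j) * (2 * k + 3))
    (2 * k + 3 + 1 + (k + 3) + ((1 + j) * (2 * k + 3)) ≡ (2 + j) * (2 * k + 3) + k + 4 ∋ solve (j ∷ k ∷ []))
  middle-bottomSeq (suc (suc i)) (suc j) b with <-cmp i j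
  ... | tri< lt _ _ with m≤n⇒∃[o]m+o≡n lt
  ...   | d , refl = radio-k↑ 3 0 refl z≤n $ m+o≡n⇒m≤n (d * (2 * k + 3) + 2 * k + 1)
      ((2 + i) * (2 * k + 3) + 3 + (k + 3) + (d * (2 * k + 3) + 2 * k + 1)
        ≡ (2 + (1 + (i + d))) * (2 * k + 3) + k + 4 ∋ solve (i ∷ d ∷ k ∷ []))
  middle-bottomSeq (suc (suc i)) (suc j) b | tri≈ _ refl _ =
    radio-k↑ 1 2 refl (distinct-leaves b (>⇒≢ (n<1+n (suc i))) (λ ()) (λ ())) $ m+o≡n⇒m≤n 0
      ((2 + i) * (2 * k + 3) + 3 + (k + 1) + 0 ≡ (2 + i) * (2 * k + 3) + k + 4 ∋ solve (i ∷ k ∷ []))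
  middle-bottomSeq (suc (suc i)) (suc j) b | tri> _ _ gt with m≤n⇒∃[o]m+o≡n gt
  ...   | d , refl =
      radio-k↓ 2 1 refl (distinct b (>⇒≢ (s≤s (s≤s (m≤n⇒m≤o+n 1 (m≤m+n j d)))))) $ m+o≡n⇒m≤n (d * (2 * k + 3))
        ((2 + j) * (2 * k + 3) + k + 4 + (k + 2) + (d * (2 * k + 3))
          ≡ (2 + (1 + (j + d))) * (2 * k + 3) + 3 ∋ solve (j ∷ d ∷ k ∷ []))

  middle-bottom : ∀ i j {D} → StarBounds i j D → Radio (middle i) (bottom j) D k
  middle-bottom i j b with j ≟ 4 + M
  ... | no _ = middle-bottomSeq i j b
  ... | yes refl = middle-bottomLast i b

  middle-top : ∀ i j → i < 5 + M → ∀ {D} → StarBounds i j D → Radio (middle i) (top j) D k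
  middle-top zero zero _ _ = radio-k↑ 3 0 refl z≤n $ m+o≡n⇒m≤n ((4 + M) * (2 * k + 3) + 3)
    (0 + (k + 3) + ((4 + M) * (2 * k + 3) + 3) ≡ 1 + ((4 + M) * (2 * k + 3) + k + 5) ∋ solve (M ∷ k ∷ []))
  middle-top (suc zero) zero _ _ = radio-k↑ 3 0 refl z≤n $ m+o≡n⇒m≤n ((3 + M) * (2 * k + 3) + 2)
    (2 * k + 3 + 1 + (k + 3) + ((3 + M) * (2 * k + 3) + 2) ≡ 1 + ((4 + M) * (2 * k + 3) + k + 5) ∋ solve (M ∷ k ∷ []))
  middle-top (suc (suc i)) zero i<m _ = radio-k↑ 3 0 refl z≤n $
    ≤-trans (+-monoˡ-≤ (k + 3) (Middle.monotone (≤-pred i<m)))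
      (≤-reflexive ((2 + (2 + M)) * (2 * k + 3) + 3 + (k + 3)
        ≡ 1 + ((4 + M) * (2 * k + 3) + k + 5) ∋ solve (M ∷ k ∷ [])))
  middle-top zero (suc zero) _ _ = radio-k↑ 3 0 refl z≤n $ m+o≡n⇒m≤n ((3 + M) * (2 * k + 3) + 2)
    (0 + (k + 3) + ((3 + M) * (2 * k + 3) + 2) ≡ (3 + M) * (2 * k + 3) + k + 5 ∋ solve (M ∷ k ∷ []))
  middle-top (suc zero) (suc zero) _ _ = radio-k↑ 3 0 refl z≤n $ m+o≡n⇒m≤n ((2 + M) * (2 * k + 3) + 1)
    (2 * k + 3 + 1 + (k + 3) + ((2 + M) * (2 * k + 3) + 1) ≡ (3 + M) * (2 * k + 3) + k + 5 ∋ solve (M ∷ k ∷ []))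
  middle-top (suc (suc i)) (suc zero) i<m b with m≤n⇒m<n∨m≡n (≤-pred (≤-pred (≤-pred i<m)))
  ... | inj₂ refl = radio-k↓ 1 2 refl (distinct-leaves b (λ ()) (λ ()) (λ ())) $ m+o≡n⇒m≤n 0
    ((3 + M) * (2 * k + 3) + k + 5 + (k + 1) + 0 ≡ (2 + (2 + M)) * (2 * k + 3) + 3 ∋ solve (M ∷ k ∷ []))
  ... | inj₁ i<2+M = radio-k↑ 2 1 refl (distinct b (λ ())) $
    ≤-trans (+-monoˡ-≤ (k + 2) (Middle.monotone (s≤s i<2+M)))
      (≤-reflexive ((2 + (1 + M)) * (2 * k + 3) + 3 + (k + 2) ≡ (3 + M) * (2 * k + 3) + k + 5 ∋ solve (M ∷ k ∷ [])))
  middle-top zero (suc (suc zero)) _ _ = radio-k↑ 3 0 refl z≤n $ m+o≡n⇒m≤n 0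
    (0 + (k + 3) + 0 ≡ k + 3 ∋ solve (k ∷ []))
  middle-top (suc zero) (suc (suc zero)) _ b =
    radio-k↓ 1 2 refl (distinct-leaves b (λ ()) (λ ()) (λ ())) $ m+o≡n⇒m≤n 0
      (k + 3 + (k + 1) + 0 ≡ 2 * k + 3 + 1 ∋ solve (k ∷ []))
  middle-top (suc (suc i)) (suc (suc zero)) _ _ = radio-k↓ 3 0 refl z≤n $ m+o≡n⇒m≤n (i * (2 * k + 3) + 2 * k + 3)
    (k + 3 + (k + 3) + (i * (2 * k + 3) + 2 * k + 3) ≡ (2 + i) * (2 * k + 3) + 3 ∋ solve (i ∷ k ∷ []))
  middle-top zero (suc (suc (suc j))) _ _ = radio-k↑ 3 0 refl z≤n $ m+o≡n⇒m≤n ((1 + j) * (2 * k + 3) + 2)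
    (0 + (k + 3) + ((1 + j) * (2 * k + 3) + 2) ≡ (1 + j) * (2 * k + 3) + k + 5 ∋ solve (j ∷ k ∷ []))
  middle-top (suc zero) (suc (suc (suc j))) _ _ = radio-k↑ 3 0 refl z≤n $ m+o≡n⇒m≤n (j * (2 * k + 3) + 1)
    (2 * k + 3 + 1 + (k + 3) + (j * (2 * k + 3) + 1) ≡ (1 + j) * (2 * k + 3) + k + 5 ∋ solve (j ∷ k ∷ []))
  middle-top (suc (suc i)) (suc (suc (suc j))) _ b with <-cmp i j
  ... | tri< lt _ _ with m≤n⇒∃[o]m+o≡n lt
  ...   | d , refl =
      radio-k↑ 2 1 refl (distinct b (<⇒≢ (s≤s (s≤s (s≤s (m≤n⇒m≤o+n 1 (m≤m+n i d))))))) $ m+o≡n⇒m≤n (d * (2 * k + 3))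
        ((2 + i) * (2 * k + 3) + 3 + (k + 2) + (d * (2 * k + 3))
          ≡ (2 + (i + d)) * (2 * k + 3) + k + 5 ∋ solve (i ∷ d ∷ k ∷ []))
  middle-top (suc (suc i)) (suc (suc (suc j))) _ b | tri≈ _ refl _ =
    radio-k↓ 1 2 refl (distinct-leaves b (<⇒≢ (n<1+n (suc (suc i)))) (λ ()) (λ ())) $ m+o≡n⇒m≤n 0
      ((1 + i) * (2 * k + 3) + k + 5 + (k + 1) + 0 ≡ (2 + i) * (2 * k + 3) + 3 ∋ solve (i ∷ k ∷ []))
  middle-top (suc (suc i)) (suc (suc (suc j))) _ b | tri> _ _ gt with m≤n⇒∃[o]m+o≡n gt
  ...   | d , refl = radio-k↓ 3 0 refl z≤n $ m+o≡n⇒m≤n (d * (2 * k + 3) + 2 * k + 1)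
      ((1 + j) * (2 * k + 3) + k + 5 + (k + 3) + (d * (2 * k + 3) + 2 * k + 1)
        ≡ (2 + (1 + (j + d))) * (2 * k + 3) + 3 ∋ solve (j ∷ d ∷ k ∷ []))

  bottomLast-top : ∀ j {D} → StarBounds (4 + M) j D → Radio (k + 2) (top j) D (2 * k)
  bottomLast-top zero _ = radio-2k↑ 3 0 refl z≤n $ m+o≡n⇒m≤n ((4 + M) * (2 * k + 3) + 1)
    (k + 2 + 3 + ((4 + M) * (2 * k + 3) + 1) ≡ 1 + ((4 + M) * (2 * k + 3) + k + 5) ∋ solve (M ∷ k ∷ []))
  bottomLast-top (suc zero) _ = radio-2k↑ 3 0 refl z≤n $ m+o≡n⇒m≤n ((3 + M) * (2 * k + 3))
    (k + 2 + 3 + ((3 + M) * (2 * k + 3)) ≡ (3 + M) * (2 * k + 3) + k + 5 ∋ solve (M ∷ k ∷ []))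
  bottomLast-top (suc (suc zero)) b = radio-2k↑ 1 2 refl (distinct-leaves b (λ ()) (λ ()) (λ ())) $ m+o≡n⇒m≤n 0
    (k + 2 + 1 + 0 ≡ k + 3 ∋ solve (k ∷ []))
  bottomLast-top (suc (suc (suc j))) _ = radio-2k↑ 3 0 refl z≤n $ m+o≡n⇒m≤n ((1 + j) * (2 * k + 3))
    (k + 2 + 3 + ((1 + j) * (2 * k + 3)) ≡ (1 + j) * (2 * k + 3) + k + 5 ∋ solve (j ∷ k ∷ []))

  bottomSeq-top : ∀ i j → i ≤ 3 + M → ∀ {D} → StarBounds i j D → Radio (bottomSeq i) (top j) D (2 * k)
  bottomSeq-top zero zero _ _ = radio-2k↑ 3 0 refl z≤n $ m+o≡n⇒m≤n ((3 + M) * (2 * k + 3))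
    (2 * k + 3 + k + 3 + 3 + ((3 + M) * (2 * k + 3)) ≡ 1 + ((4 + M) * (2 * k + 3) + k + 5) ∋ solve (M ∷ k ∷ []))
  bottomSeq-top zero (suc zero) _ b =
    radio-2k↑ 2 1 refl (distinct b (λ ())) $ m+o≡n⇒m≤n ((2 + M) * (2 * k + 3))
      (2 * k + 3 + k + 3 + 2 + ((2 + M) * (2 * k + 3)) ≡ (3 + M) * (2 * k + 3) + k + 5 ∋ solve (M ∷ k ∷ []))
  bottomSeq-top zero (suc (suc zero)) _ _ = radio-2k↓ 3 0 refl z≤n $ m+o≡n⇒m≤n (2 * k)
    (k + 3 + 3 + (2 * k) ≡ 2 * k + 3 + k + 3 ∋ solve (k ∷ []))
  bottomSeq-top zero (suc (suc (suc j))) _ b =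
    radio-2k↑ 2 1 refl (distinct b (λ ())) $ m+o≡n⇒m≤n (j * (2 * k + 3))
      (2 * k + 3 + k + 3 + 2 + (j * (2 * k + 3)) ≡ (1 + j) * (2 * k + 3) + k + 5 ∋ solve (j ∷ k ∷ []))
  bottomSeq-top (suc i) zero i≤3+M b = radio-2k↑ 2 1 refl (distinct b (λ ())) $
    ≤-trans (+-monoˡ-≤ 2 (BottomSeq.monotone i≤3+M))
      (≤-reflexive ((2 + (2 + M)) * (2 * k + 3) + k + 4 + 2 ≡ 1 + ((4 + M) * (2 * k + 3) + k + 5) ∋ solve (M ∷ k ∷ [])))
  bottomSeq-top (suc zero) (suc zero) _ _ = radio-2k↑ 3 0 refl z≤n $ m+o≡n⇒m≤n (M * (2 * k + 3) + 2 * k + 1)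
    ((2 + 0) * (2 * k + 3) + k + 4 + 3 + (M * (2 * k + 3) + 2 * k + 1)
      ≡ (3 + M) * (2 * k + 3) + k + 5 ∋ solve (M ∷ k ∷ []))
  bottomSeq-top (suc (suc i)) (suc zero) i≤3+M b with m≤n⇒m<n∨m≡n (≤-pred (≤-pred i≤3+M))
  ... | inj₂ refl = radio-2k↓ 1 2 refl (distinct-leaves b (λ ()) (λ ()) (λ ())) $ m+o≡n⇒m≤n (2 * k + 1)
    ((3 + M) * (2 * k + 3) + k + 5 + 1 + (2 * k + 1) ≡ (2 + (1 + (1 + M))) * (2 * k + 3) + k + 4 ∋ solve (M ∷ k ∷ []))
  ... | inj₁ i<1+M = radio-2k↑ 1 2 refl (distinct-leaves b (λ ()) (λ ()) (λ ())) $
    ≤-trans (+-monoˡ-≤ 1 (BottomSeq.monotone (s≤s i<1+M)))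
      (≤-reflexive ((2 + (1 + M)) * (2 * k + 3) + k + 4 + 1 ≡ (3 + M) * (2 * k + 3) + k + 5 ∋ solve (M ∷ k ∷ [])))
  bottomSeq-top (suc i) (suc (suc zero)) _ _ =
    radio-2k↓ 3 0 refl z≤n $ m+o≡n⇒m≤n ((1 + i) * (2 * k + 3) + 2 * k + 1)
      (k + 3 + 3 + ((1 + i) * (2 * k + 3) + 2 * k + 1) ≡ (2 + i) * (2 * k + 3) + k + 4 ∋ solve (i ∷ k ∷ []))
  bottomSeq-top (suc i) (suc (suc (suc j))) _ b with <-cmp i j
  ... | tri< lt _ _ with m≤n⇒∃[o]m+o≡n lt
  ...   | d , refl =
      radio-2k↑ 1 2 refl (distinct-leaves b (<⇒≢ (s≤s (s≤s (m≤n⇒m≤o+n 2 (m≤m+n i d))))) (λ ()) (λ ())) $ m+o≡n⇒m≤n (d * (2 * k + 3))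
        ((2 + i) * (2 * k + 3) + k + 4 + 1 + (d * (2 * k + 3))
          ≡ (2 + (i + d)) * (2 * k + 3) + k + 5 ∋ solve (i ∷ d ∷ k ∷ []))
  bottomSeq-top (suc i) (suc (suc (suc j))) _ b | tri≈ _ refl _ =
    radio-2k↓ 1 2 refl (distinct-leaves b (<⇒≢ (s≤s (s≤s (n≤1+n i)))) (λ ()) (λ ())) $ m+o≡n⇒m≤n (2 * k + 1)
      ((1 + i) * (2 * k + 3) + k + 5 + 1 + (2 * k + 1) ≡ (2 + i) * (2 * k + 3) + k + 4 ∋ solve (i ∷ k ∷ []))
  bottomSeq-top (suc i) (suc (suc (suc j))) _ b | tri> _ _ gt with m≤n⇒∃[o]m+o≡n gt
  ...   | d , refl = radio-2k↓ 3 0 refl z≤n $ m+o≡n⇒m≤n (d * (2 * k + 3) + 4 * k + 2)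
      ((1 + j) * (2 * k + 3) + k + 5 + 3 + (d * (2 * k + 3) + 4 * k + 2)
        ≡ (2 + (1 + (j + d))) * (2 * k + 3) + k + 4 ∋ solve (j ∷ d ∷ k ∷ []))

  bottom-top : ∀ i j → i < 5 + M → ∀ {D} → StarBounds i j D → Radio (bottom i) (top j) D (2 * k)
  bottom-top i j i<m b with i ≟ 4 + M
  ... | no i≢last = bottomSeq-top i j (≤-pred (≤∧≢⇒< (≤-pred i<m) i≢last)) b
  ... | yes refl = bottomLast-top j b

  bottomLast+P≤bottomSeq : ∀ j → k + 2 + (2 * k + 3) ≤ bottomSeq j
  bottomLast+P≤bottomSeq j =
    ≤-trans (m+o≡n⇒m≤n 1 (k + 2 + (2 * k + 3) + 1 ≡ 2 * k + 3 + k + 3 ∋ solve (k ∷ [])))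
      (BottomSeq.monotone {0} {j} z≤n)

  bottom-separated : ∀ i j → i ≢ j → 2 * k + 3 ≤ ∣ bottom i - bottom j ∣
  bottom-separated i j i≢j with i ≟ 4 + M | j ≟ 4 + M
  ... | yes refl | yes refl = ⊥-elim (i≢j refl)
  ... | yes refl | no _ = m+g≤n⇒g≤∣m-n∣ {k + 2} {bottomSeq j} (bottomLast+P≤bottomSeq j)
  ... | no _ | yes refl = n+g≤m⇒g≤∣m-n∣ {bottomSeq i} {k + 2} (bottomLast+P≤bottomSeq i)
  ... | no _ | no _ = BottomSeq.≢⇒P≤∣-∣ i≢j

  topSeq+P≤top0 : ∀ {t} → t < 4 + M → topSeq t + (2 * k + 3) ≤ top 0
  topSeq+P≤top0 t<4+M = ≤-trans (TopSeq.<⇒+P≤ t<4+M) (n≤1+n _)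

  top-separated : ∀ i j → i < 5 + M → j < 5 + M → i ≢ j → 2 * k + 3 ≤ ∣ top i - top j ∣
  top-separated zero zero _ _ i≢j = ⊥-elim (i≢j refl)
  top-separated zero (suc zero) _ _ _ = n+g≤m⇒g≤∣m-n∣ {top 0} {top 1} (topSeq+P≤top0 ≤-refl)
  top-separated zero (suc (suc j)) _ j<m _ =
    n+g≤m⇒g≤∣m-n∣ {top 0} {topSeq j} (topSeq+P≤top0 (≤-trans (n≤1+n _) (≤-pred j<m)))
  top-separated (suc zero) zero _ _ _ = m+g≤n⇒g≤∣m-n∣ {top 1} {top 0} (topSeq+P≤top0 ≤-refl)
  top-separated (suc zero) (suc zero) _ _ i≢j = ⊥-elim (i≢j refl)
  top-separated (suc zero) (suc (suc j)) _ j<m _ =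
    n+g≤m⇒g≤∣m-n∣ {top 1} {topSeq j} (TopSeq.<⇒+P≤ (≤-pred (≤-pred j<m)))
  top-separated (suc (suc i)) zero i<m _ _ =
    m+g≤n⇒g≤∣m-n∣ {topSeq i} {top 0} (topSeq+P≤top0 (≤-trans (n≤1+n _) (≤-pred i<m)))
  top-separated (suc (suc i)) (suc zero) i<m _ _ =
    m+g≤n⇒g≤∣m-n∣ {topSeq i} {top 1} (TopSeq.<⇒+P≤ (≤-pred (≤-pred i<m)))
  top-separated (suc (suc i)) (suc (suc j)) _ _ i≢j = TopSeq.≢⇒P≤∣-∣ (i≢j ∘ cong (suc ∘ suc))

  label-radio : ∀ l l′ i j → i < 5 + M → j < 5 + M → ∀ {D} → StarBounds i j D → (i ≡ j → l ≢ l′) →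
    Radio (label l i) (label l′ j) D (levelGap k l l′)
  label-radio fz fz i j _ _ _ same = radio-same-level (bottom-separated i j (λ i≡j → same i≡j refl))
  label-radio fz (fs fz) i j _ _ b _ = radio-sym (middle-bottom j i (StarBounds-sym b))
  label-radio fz (fs (fs fz)) i j i<m _ b _ = bottom-top i j i<m b
  label-radio (fs fz) fz i j _ _ b _ = middle-bottom i j b
  label-radio (fs fz) (fs fz) i j _ _ _ same = radio-same-level (Middle.≢⇒P≤∣-∣ (λ i≡j → same i≡j refl))
  label-radio (fs fz) (fs (fs fz)) i j i<m _ b _ = middle-top i j i<m b
  label-radio (fs (fs fz)) fz i j _ j<m b _ = radio-sym (bottom-top j i j<m (StarBounds-sym b))
  label-radio (fs (fs fz)) (fs fz) i j _ j<m b _ = radio-sym (middle-top j i j<m (StarBounds-sym b))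
  label-radio (fs (fs fz)) (fs (fs fz)) i j i<m j<m _ same =
    radio-same-level (top-separated i j i<m j<m (λ i≡j → same i≡j refl))

  label≤top0 : ∀ l i → i < 5 + M → label l i ≤ top 0
  label≤top0 fz i i<m with i ≟ 4 + M
  ... | yes _ = m+o≡n⇒m≤n ((4 + M) * (2 * k + 3) + 4)
    (k + 2 + ((4 + M) * (2 * k + 3) + 4) ≡ 1 + ((4 + M) * (2 * k + 3) + k + 5) ∋ solve (M ∷ k ∷ []))
  ... | no i≢last = ≤-trans (BottomSeq.monotone (≤-pred (≤∧≢⇒< (≤-pred i<m) i≢last)))
    (m+o≡n⇒m≤n 2 ((4 + M) * (2 * k + 3) + k + 4 + 2 ≡ 1 + ((4 + M) * (2 * k + 3) + k + 5) ∋ solve (M ∷ k ∷ [])))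
  label≤top0 (fs fz) i i<m = ≤-trans (Middle.monotone (≤-pred i<m))
    (m+o≡n⇒m≤n (k + 3) ((4 + M) * (2 * k + 3) + 3 + (k + 3) ≡ 1 + ((4 + M) * (2 * k + 3) + k + 5) ∋ solve (M ∷ k ∷ [])))
  label≤top0 (fs (fs fz)) zero _ = ≤-refl
  label≤top0 (fs (fs fz)) (suc zero) _ = m+n≤o⇒m≤o _ (topSeq+P≤top0 ≤-refl)
  label≤top0 (fs (fs fz)) (suc (suc j)) i<m = m+n≤o⇒m≤o _ (topSeq+P≤top0 (≤-trans (n≤1+n _) (≤-pred i<m)))

labeling : (M k : ℕ) → Fin (5 + M) × Fin 3 → ℕ
labeling M k (a , l) = Labeling.label M k l (toℕ a)

labeling-isRadio : ∀ M k → IsRadioLabeling (5 + M) (2 * k + 1) (labeling M k)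
labeling-isRadio M k (a , l) (b , l′) u≢v =
  subst (λ z → 2 * k + 1 + 1 + 1 ≤ ∣ labeling M k (a , l) - labeling M k (b , l′) ∣ + (dStar a b + z))
    (sym (∣level-level∣≡levelGap k l l′))
    (Radio.bound (label-radio l l′ (toℕ a) (toℕ b) (toℕ<n a) (toℕ<n b) (dStar-bounds a b) same))
  where
  open Labeling M k
  same : toℕ a ≡ toℕ b → l ≢ l′
  same a≡b l≡l′ = u≢v (cong₂ (λ x y → x , level (2 * k + 1) y) (toℕ-injective a≡b) l≡l′)

labeling-span : ∀ M k →
  2 * span (5 + M) (2 * k + 1) (labeling M k) + (2 * k + 1) ≤ 2 * (5 + M) * (2 * k + 1) + 4 * (5 + M) + 7
labeling-span M k = begin
  2 * span (5 + M) (2 * k + 1) (labeling M k) + (2 * k + 1)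
    ≤⟨ +-monoˡ-≤ (2 * k + 1) (*-monoʳ-≤ 2 (span-≤ (5 + M) (2 * k + 1) (labeling M k) label≤)) ⟩
  2 * (1 + ((4 + M) * (2 * k + 3) + k + 5)) + (2 * k + 1)
    ≡⟨ solve (M ∷ k ∷ []) ⟩
  2 * (5 + M) * (2 * k + 1) + 4 * (5 + M) + 7 ∎
  where
  open ≤-Reasoning
  label≤ : ∀ x → labeling M k x ≤ Labeling.top M k 0
  label≤ (a , l) = Labeling.label≤top0 M k l (toℕ a) (toℕ<n a)

lemma8 : (m n k : ℕ) → 5 ≤ m → 3 ≤ n → n ≡ 2 * k + 1 →
    Σ (Fin m × Fin 3 → ℕ) λ f →
    IsRadioLabeling m n f × (2 * span m n f + n ≤ 2 * m * n + 4 * m + 7)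
lemma8 .(5 + M) .(2 * k + 1) k (s≤s (s≤s (s≤s (s≤s (s≤s (z≤n {M})))))) _ refl =
  labeling M k , labeling-isRadio M k , labeling-span M k
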